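{- Let $m\ge4$ and let $1<d_1<\dots<d_m$ be integers with $\gcd(d_1,\dots,d_m)=1$ forming a minimal generating set of the numerical semigroup $S(d_1,\dots,d_m)$. For $j=2,\dots,m$ let $a_{jj}=\min\{v\ge2:\ v d_j=\sum_{i\ne j}v_{ji}d_i \text{ for some } v_{ji}\in\mathbb Z_{\ge0}\}$. Then $$\sum_{j=2}^m a_{jj}\le d_1+2(m-1)\Big(1-\frac{1}{2^{m-1}}\Big).$$
   Context: $S(d_1,\dots,d_m)$ is the set of nonnegative integer combinations of $d_1,\dots,d_m$. The generating set is minimal if no $d_i$ is a nonnegative integer combination of the others. -}

module Defs where

open import Data.Nat using (ℕ; _+_; _*_; _≤_; _<_)
open import Data.Nat.GCD using (gcd)
open import Data.Fin using (Fin)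
open import Data.Product using (Σ; _×_)
open import Data.Vec.Functional using (foldr)
open import Relation.Binary.PropositionalEquality using (_≡_)
open import Relation.Nullary using (¬_)

Σ[_] : ∀ {m} → (Fin m → ℕ) → ℕ
Σ[ f ] = foldr _+_ 0 f

gcdAll : ∀ {m} → (Fin m → ℕ) → ℕ
gcdAll d = foldr gcd 0 d

CombOthers : ∀ {m} → (Fin m → ℕ) → Fin m → ℕ → Set
CombOthers {m} d j x =
  Σ (Fin m → ℕ) λ c → (c j ≡ 0) × (x ≡ Σ[ (λ i → c i * d i) ])

StrictlyIncreasing : ∀ {m} → (Fin m → ℕ) → Set
StrictlyIncreasing {m} d = ∀ (i k : Fin m) → Data.Fin._<_ i k → d i < d k

MinimalGenerating : ∀ {m} → (Fin m → ℕ) → Set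
MinimalGenerating {m} d = ∀ (j : Fin m) → ¬ CombOthers d j (d j)

IsAjj : ∀ {m} → (Fin m → ℕ) → Fin m → ℕ → Set
IsAjj d j a =
  (2 ≤ a) × CombOthers d j (a * d j) ×
  (∀ v → 2 ≤ v → CombOthers d j (v * d j) → a ≤ v)

{-# OPTIONS --safe #-}
module Submission where

-- Let S be the semigroup generated by d₀ = d zero and the d_j. Its Apéry set with respect to
-- d₀, the s ∈ S with s − d₀ ∉ S, meets every residue class mod d₀ at most once: if s < s' are
-- congruent then s' − d₀ = s + t d₀ ∈ S. It therefore has at most d₀ elements.
-- Each v d_j with v < a_jj lies in it: from v d_j = d₀ + s, splitting off the d_j-part k d_j
-- of s yields (v − k) d_j = d₀ + s' with s' built from the other generators, contradicting
-- either minimality of the generating set (v − k = 1) or minimality of a_jj. These elements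
-- are distinct, since v d_j = w d_k with j ≠ k and 0 < v < a_jj is again such a forbidden
-- representation. Counting 0 and the v d_j with 0 < v < a_jj gives 1 + Σ (a_jj − 1) ≤ d₀,
-- i.e. Σ a_jj ≤ d₀ + n − 1, which is stronger than the stated bound.

open import Defs
open import Data.Fin as Fin using (Fin; zero; toℕ) renaming (suc to fsuc)
open import Data.Fin.Properties
  using (pigeonhole; toℕ-fromℕ<) renaming (suc-injective to fsuc-injective)
open import Data.List using (List; []; _∷_; applyUpTo; concat; length; lookup; tabulate)
open import Data.List.Membership.Propositional using (_∈_)
open import Data.List.Membership.Propositional.Properties using (∈-applyUpTo⁻; ∈-lookup)
open import Data.List.Properties using (length-++; length-applyUpTo)
open import Data.List.Relation.Binary.Disjoint.Propositional using (Disjoint)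
open import Data.List.Relation.Unary.All as All using (All; []; _∷_)
import Data.List.Relation.Unary.All.Properties as All
open import Data.List.Relation.Unary.AllPairs using (AllPairs; []; _∷_)
import Data.List.Relation.Unary.AllPairs.Properties as AllPairs
open import Data.List.Relation.Unary.Unique.Propositional using (Unique)
import Data.List.Relation.Unary.Unique.Propositional.Properties as Unique
open import Data.Nat
  using (ℕ; zero; suc; _+_; _*_; _∸_; _^_; _%_; _/_; _≤_; _<_; _≤?_; z≤n; s≤s; z<s; s<s; NonZero; >-nonZero)
open import Data.Nat.DivMod using (_mod_; m≡m%n+[m/n]*n)
open import Data.Nat.Properties
open import Algebra.Properties.Monoid.Sum +-0-monoid using (sum-cong-≗; sum-replicate-zero)
open import Data.Nat.Solver using (module +-*-Solver)
open import Data.Product using (Σ; ∃-syntax; _×_; _,_; proj₁; proj₂)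
open import Data.Vec.Functional using (head; tail; updateAt)
open import Data.Vec.Functional.Properties using (updateAt-updates; updateAt-minimal)
open import Function using (_∘_; _on_)
open import Relation.Binary.PropositionalEquality
  using (_≡_; _≢_; refl; sym; trans; cong; cong₂; subst; subst₂; module ≡-Reasoning)
open import Relation.Nullary using (¬_; yes; no; contradiction)

open +-*-Solver using (solve; con; _:+_; _:*_; _:=_)

<∸1⇒suc< : ∀ {v} a → v < a ∸ 1 → suc v < a
<∸1⇒suc< (suc a) v<a = s<s v<a

Σ[f]≤Σ[f∸1]+n : ∀ {n} (f : Fin n → ℕ) → Σ[ f ] ≤ Σ[ (λ i → f i ∸ 1) ] + n
Σ[f]≤Σ[f∸1]+n {zero}  f = z≤n
Σ[f]≤Σ[f∸1]+n {suc n} f = begin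
  f zero + Σ[ f ∘ fsuc ]                  ≤⟨ +-mono-≤ (m≤n+m∸n (f zero) 1) (Σ[f]≤Σ[f∸1]+n (f ∘ fsuc)) ⟩
  suc (f zero ∸ 1) + (Σ[ g ∘ fsuc ] + n)  ≡⟨ solve 3 (λ x s n → (con 1 :+ x) :+ (s :+ n) := (x :+ s) :+ (con 1 :+ n))
                                                   refl (f zero ∸ 1) Σ[ g ∘ fsuc ] n ⟩
  Σ[ g ] + suc n                          ∎
  where
  open ≤-Reasoning
  g = λ i → f i ∸ 1

m<n+o⇒p*m≤p*n+2*o*[p∸1] : ∀ {m n o p} → 2 ≤ p → m < n + o → p * m ≤ p * n + 2 * o * (p ∸ 1)
m<n+o⇒p*m≤p*n+2*o*[p∸1] {m} {n} {o} {p@(suc p∸1@(suc _))} (s≤s (s≤s z≤n)) m<n+o =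
  +-cancelʳ-≤ p (p * m) _ (begin
    p * m + p                         ≡⟨ +-comm (p * m) p ⟩
    p + p * m                         ≡⟨ *-suc p m ⟨
    p * suc m                         ≤⟨ *-monoʳ-≤ p m<n+o ⟩
    p * (n + o)                       ≡⟨ *-distribˡ-+ p n o ⟩
    p * n + (o + p∸1 * o)             ≤⟨ +-monoʳ-≤ (p * n) (+-monoˡ-≤ (p∸1 * o) (m≤n*m o p∸1)) ⟩
    p * n + (p∸1 * o + p∸1 * o)       ≡⟨ cong (p * n +_) (solve 2 (λ q o → q :* o :+ q :* o := con 2 :* o :* q)
                                                                 refl p∸1 o) ⟩
    p * n + 2 * o * p∸1               ≤⟨ m≤m+n _ p ⟩
    p * n + 2 * o * p∸1 + p           ∎)
  where open ≤-Reasoning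

AllPairs-lookup : ∀ {A : Set} {R : A → A → Set} {xs : List A} → AllPairs R xs →
                  ∀ {i j} → i Fin.< j → R (lookup xs i) (lookup xs j)
AllPairs-lookup (Rx ∷ _)   {zero}   {fsuc j} _         = All.lookup Rx (∈-lookup j)
AllPairs-lookup (_ ∷ Rxs) {fsuc i} {fsuc j} (s<s i<j) = AllPairs-lookup Rxs i<j

length≤-of-AllPairs-≢-on : ∀ {A : Set} {q} (f : A → Fin q) {xs : List A} →
                           AllPairs (_≢_ on f) xs → length xs ≤ q
length≤-of-AllPairs-≢-on {q = q} f {xs} distinct with length xs ≤? q
... | yes |xs|≤q = |xs|≤q
... | no  |xs|≰q =
  let i , j , i<j , fᵢ≡fⱼ = pigeonhole (≰⇒> |xs|≰q) (f ∘ lookup xs)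
  in  contradiction fᵢ≡fⱼ (AllPairs-lookup distinct i<j)

length-concat-tabulate : ∀ {A : Set} {k} (xss : Fin k → List A) →
                         length (concat (tabulate xss)) ≡ Σ[ length ∘ xss ]
length-concat-tabulate {k = zero}  xss = refl
length-concat-tabulate {k = suc k} xss =
  trans (length-++ (xss zero)) (cong (length (xss zero) +_) (length-concat-tabulate (xss ∘ fsuc)))

infix 7 _·_
infix 4 _∈⟨_⟩

_·_ : ∀ {m} → (Fin m → ℕ) → (Fin m → ℕ) → ℕ
c · d = Σ[ (λ i → c i * d i) ]

_∈⟨_⟩ : ∀ {m} → ℕ → (Fin m → ℕ) → Set
x ∈⟨ d ⟩ = Σ (Fin _ → ℕ) λ c → x ≡ c · d

·-zeroˡ : ∀ {m} (d : Fin m → ℕ) → (λ _ → 0) · d ≡ 0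
·-zeroˡ {m} d = sum-replicate-zero m

·-updateAt : ∀ {m} (c d : Fin m → ℕ) i (f : ℕ → ℕ) →
             updateAt c i f · d + c i * d i ≡ c · d + f (c i) * d i
·-updateAt c d zero f =
  solve 3 (λ x y s → x :+ s :+ y := y :+ s :+ x) refl
          (f (c zero) * d zero) (c zero * d zero) (tail c · tail d)
·-updateAt c d (fsuc i) f = begin
  head c * head d + updateAt (tail c) i f · tail d + c (fsuc i) * d (fsuc i)
    ≡⟨ +-assoc (head c * head d) _ _ ⟩
  head c * head d + (updateAt (tail c) i f · tail d + c (fsuc i) * d (fsuc i))
    ≡⟨ cong (head c * head d +_) (·-updateAt (tail c) (tail d) i f) ⟩
  head c * head d + (tail c · tail d + f (c (fsuc i)) * d (fsuc i))
    ≡⟨ +-assoc (head c * head d) _ _ ⟨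
  c · d + f (c (fsuc i)) * d (fsuc i) ∎
  where open ≡-Reasoning

·-updateAt-suc : ∀ {m} (c d : Fin m → ℕ) i → updateAt c i suc · d ≡ d i + c · d
·-updateAt-suc c d i = +-cancelʳ-≡ (c i * d i) _ _ (begin
  updateAt c i suc · d + c i * d i   ≡⟨ ·-updateAt c d i suc ⟩
  c · d + (d i + c i * d i)          ≡⟨ +-assoc (c · d) (d i) _ ⟨
  c · d + d i + c i * d i            ≡⟨ cong (_+ c i * d i) (+-comm (c · d) (d i)) ⟩
  d i + c · d + c i * d i            ∎)
  where open ≡-Reasoning

·-updateAt-0 : ∀ {m} (c d : Fin m → ℕ) i → updateAt c i (λ _ → 0) · d + c i * d i ≡ c · d
·-updateAt-0 c d i = trans (·-updateAt c d i (λ _ → 0)) (+-identityʳ (c · d))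

·-single : ∀ {m} (d : Fin m → ℕ) i v → updateAt (λ _ → 0) i (λ _ → v) · d ≡ v * d i
·-single d i v = begin
  updateAt (λ _ → 0) i (λ _ → v) · d       ≡⟨ +-identityʳ _ ⟨
  updateAt (λ _ → 0) i (λ _ → v) · d + 0   ≡⟨ ·-updateAt (λ _ → 0) d i (λ _ → v) ⟩
  (λ _ → 0) · d + v * d i                  ≡⟨ cong (_+ v * d i) (·-zeroˡ d) ⟩
  v * d i                                  ∎
  where open ≡-Reasoning

0∈⟨⟩ : ∀ {m} (d : Fin m → ℕ) → 0 ∈⟨ d ⟩
0∈⟨⟩ d = (λ _ → 0) , sym (·-zeroˡ d)

*-∈⟨⟩ : ∀ {m} (d : Fin m → ℕ) v i → v * d i ∈⟨ d ⟩
*-∈⟨⟩ d v i = updateAt (λ _ → 0) i (λ _ → v) , sym (·-single d i v)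

+-∈⟨⟩ : ∀ {m} {d : Fin m → ℕ} i {x} → x ∈⟨ d ⟩ → d i + x ∈⟨ d ⟩
+-∈⟨⟩ {d = d} i (c , refl) = updateAt c i suc , sym (·-updateAt-suc c d i)

*-CombOthers : ∀ {m} (d : Fin m → ℕ) {j k} → k ≢ j → ∀ w → CombOthers d j (w * d k)
*-CombOthers d {j} {k} k≢j w =
  updateAt (λ _ → 0) k (λ _ → w) , updateAt-minimal j k _ (k≢j ∘ sym) , sym (·-single d k w)

MinimalGenerating⇒positive : ∀ {m} {d : Fin m → ℕ} → MinimalGenerating d → ∀ j → 0 < d j
MinimalGenerating⇒positive {d = d} mg j =
  n≢0⇒n>0 λ dⱼ≡0 → mg j ((λ _ → 0) , refl , trans dⱼ≡0 (sym (·-zeroˡ d)))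

-- x lies in P and x − q does not, stated without truncated subtraction.
Apéry : (ℕ → Set) → ℕ → ℕ → Set
Apéry P q x = P x × (∀ {y} → P y → x ≢ q + y)

module _ {q} .{{_ : NonZero q}} where

  %-≡-<⇒≡+* : ∀ {x y} → y < x → x % q ≡ y % q → ∃[ t ] x ≡ q + (t * q + y)
  %-≡-<⇒≡+* {x} {y} y<x x%q≡y%q = t , (begin
    x                                    ≡⟨ m≡m%n+[m/n]*n x q ⟩
    x % q + x / q * q                    ≡⟨ cong₂ (λ r k → r + k * q) x%q≡y%q (sym 1+y/q+t≡x/q) ⟩
    y % q + (suc (y / q) + t) * q        ≡⟨ solve 4 (λ r k t q → r :+ ((con 1 :+ k) :+ t) :* q
                                                          := q :+ (t :* q :+ (r :+ k :* q)))
                                                  refl (y % q) (y / q) t q ⟩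
    q + (t * q + (y % q + y / q * q))    ≡⟨ cong (λ z → q + (t * q + z)) (m≡m%n+[m/n]*n y q) ⟨
    q + (t * q + y)                      ∎)
    where
    open ≡-Reasoning
    y/q<x/q : y / q < x / q
    y/q<x/q = *-cancelʳ-< q _ _ (+-cancelˡ-< (y % q) _ _
      (subst₂ _<_ (m≡m%n+[m/n]*n y q) (trans (m≡m%n+[m/n]*n x q) (cong (_+ x / q * q) x%q≡y%q)) y<x))
    t = proj₁ (m≤n⇒∃[o]m+o≡n y/q<x/q)
    1+y/q+t≡x/q = proj₂ (m≤n⇒∃[o]m+o≡n y/q<x/q)

  module _ {P : ℕ → Set} (P-+q : ∀ {x} → P x → P (q + x)) where

    P-+*q : ∀ t {x} → P x → P (t * q + x)
    P-+*q zero    Px = Px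
    P-+*q (suc t) {x} Px = subst P (sym (+-assoc q (t * q) x)) (P-+q (P-+*q t Px))

    Apéry-≤ : ∀ {x y} → (∀ {z} → P z → x ≢ q + z) → P y → x % q ≡ y % q → x ≤ y
    Apéry-≤ {x} {y} x∉q+P Py x%q≡y%q with x ≤? y
    ... | yes x≤y = x≤y
    ... | no  x≰y =
      let t , x≡q+tq+y = %-≡-<⇒≡+* (≰⇒> x≰y) x%q≡y%q
      in  contradiction x≡q+tq+y (x∉q+P (P-+*q t Py))

    Apéry-mod-injective : ∀ {x y} → Apéry P q x → Apéry P q y → x mod q ≡ y mod q → x ≡ y
    Apéry-mod-injective (Px , x∉q+P) (Py , y∉q+P) x≡y[mod] =
      ≤-antisym (Apéry-≤ x∉q+P Py x%q≡y%q) (Apéry-≤ y∉q+P Px (sym x%q≡y%q))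
      where
      x%q≡y%q = trans (sym (toℕ-fromℕ< _)) (trans (cong toℕ x≡y[mod]) (toℕ-fromℕ< _))

    Apéry-length≤ : ∀ {xs} → All (Apéry P q) xs → Unique xs → length xs ≤ q
    Apéry-length≤ Ap-xs Unique-xs =
      length≤-of-AllPairs-≢-on (_mod q) (mod-distinct Ap-xs Unique-xs)
      where
      mod-distinct : ∀ {xs} → All (Apéry P q) xs → Unique xs → AllPairs (_≢_ on (_mod q)) xs
      mod-distinct []            []              = []
      mod-distinct (Apx ∷ Apxs) (x∉xs ∷ Unique-xs) =
        All.zipWith (λ (Apy , x≢y) → x≢y ∘ Apéry-mod-injective Apx Apy) (Apxs , x∉xs)
        ∷ mod-distinct Apxs Unique-xs

module _ {m} {d : Fin m → ℕ} {j : Fin m} {a : ℕ}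
         (dⱼ-irreducible : ¬ CombOthers d j (d j)) (isAjj : IsAjj d j a) where

  ¬CombOthers-below-Ajj : ∀ {v} → 0 < v → v < a → ¬ CombOthers d j (v * d j)
  ¬CombOthers-below-Ajj {suc zero}    _ _   = dⱼ-irreducible ∘ subst (CombOthers d j) (*-identityˡ (d j))
  ¬CombOthers-below-Ajj {suc (suc v)} _ v<a = <⇒≱ v<a ∘ proj₂ (proj₂ isAjj) _ (s≤s (s≤s z≤n))

  multiple-Apéry : ∀ {i v} → i ≢ j → 0 < d i → v < a → Apéry (_∈⟨ d ⟩) (d i) (v * d j)
  multiple-Apéry {i} {v} i≢j 0<dᵢ v<a = *-∈⟨⟩ d v j , vdⱼ∉dᵢ+S
    where
    vdⱼ∉dᵢ+S : ∀ {s} → s ∈⟨ d ⟩ → v * d j ≢ d i + s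
    vdⱼ∉dᵢ+S (c , refl) vdⱼ≡dᵢ+s with v ≤? c j
    ... | yes v≤cⱼ = <⇒≢ vdⱼ<dᵢ+s vdⱼ≡dᵢ+s
      where
      open ≤-Reasoning
      vdⱼ<dᵢ+s : v * d j < d i + c · d
      vdⱼ<dᵢ+s = begin-strict
        v * d j                                  ≤⟨ *-monoˡ-≤ (d j) v≤cⱼ ⟩
        c j * d j                                ≤⟨ m≤n+m _ _ ⟩
        updateAt c j (λ _ → 0) · d + c j * d j   ≡⟨ ·-updateAt-0 c d j ⟩
        c · d                                    <⟨ m<n+m (c · d) 0<dᵢ ⟩
        d i + c · d                              ∎
    ... | no  v≰cⱼ = ¬CombOthers-below-Ajj (m<n⇒0<n∸m cⱼ<v) (≤-<-trans (m∸n≤m v (c j)) v<a)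
                       (updateAt c′ i suc , c″ⱼ≡0 , [v∸cⱼ]dⱼ≡c″·d)
      where
      open ≡-Reasoning
      cⱼ<v = ≰⇒> v≰cⱼ
      c′ = updateAt c j (λ _ → 0)
      c″ⱼ≡0 : updateAt c′ i suc j ≡ 0
      c″ⱼ≡0 = trans (updateAt-minimal j i c′ (i≢j ∘ sym)) (updateAt-updates j c)
      [v∸cⱼ]dⱼ≡c″·d : (v ∸ c j) * d j ≡ updateAt c′ i suc · d
      [v∸cⱼ]dⱼ≡c″·d = +-cancelʳ-≡ (c j * d j) _ _ (begin
        (v ∸ c j) * d j + c j * d j     ≡⟨ *-distribʳ-+ (d j) (v ∸ c j) (c j) ⟨
        (v ∸ c j + c j) * d j           ≡⟨ cong (_* d j) (m∸n+n≡m (<⇒≤ cⱼ<v)) ⟩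
        v * d j                         ≡⟨ vdⱼ≡dᵢ+s ⟩
        d i + c · d                     ≡⟨ cong (d i +_) (·-updateAt-0 c d j) ⟨
        d i + (c′ · d + c j * d j)      ≡⟨ +-assoc (d i) _ _ ⟨
        d i + c′ · d + c j * d j        ≡⟨ cong (_+ c j * d j) (·-updateAt-suc c′ d i) ⟨
        updateAt c′ i suc · d + c j * d j ∎)

module _ {n} {d : Fin (suc n) → ℕ} (mg : MinimalGenerating d)
         {a : Fin n → ℕ} (isAjj : ∀ j → IsAjj d (fsuc j) (a j)) where

  private
    positive : ∀ i → 0 < d i
    positive = MinimalGenerating⇒positive {d = d} mg

    instance
      d₀-nonZero : NonZero (d zero)
      d₀-nonZero = >-nonZero (positive zero)

  multiples-below-Ajj : Fin n → List ℕ
  multiples-below-Ajj j = applyUpTo (λ v → suc v * d (fsuc j)) (a j ∸ 1)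

  ∈-multiples-below-Ajj⁻ : ∀ {j x} → x ∈ multiples-below-Ajj j →
                           ∃[ v ] 0 < v × v < a j × x ≡ v * d (fsuc j)
  ∈-multiples-below-Ajj⁻ {j} x∈ =
    let v , v<a∸1 , x≡ = ∈-applyUpTo⁻ _ x∈ in suc v , z<s , <∸1⇒suc< (a j) v<a∸1 , x≡

  aperyList : List ℕ
  aperyList = 0 ∷ concat (tabulate multiples-below-Ajj)

  length-aperyList : length aperyList ≡ suc Σ[ (λ j → a j ∸ 1) ]
  length-aperyList = cong suc (trans (length-concat-tabulate multiples-below-Ajj)
                                     (sum-cong-≗ (λ j → length-applyUpTo _ (a j ∸ 1))))

  aperyList-Apéry : All (Apéry (_∈⟨ d ⟩) (d zero)) aperyList
  aperyList-Apéry = (0∈⟨⟩ d , λ _ → <⇒≢ (≤-trans (positive zero) (m≤m+n _ _)))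
    ∷ All.concat⁺ (All.tabulate⁺ λ j → All.applyUpTo⁺₁ _ _ λ v<a∸1 →
        multiple-Apéry {d = d} (mg (fsuc j)) (isAjj j) (λ ()) (positive zero) (<∸1⇒suc< (a j) v<a∸1))

  aperyList-Unique : Unique aperyList
  aperyList-Unique = 0∉multiples
    ∷ Unique.concat⁺ (All.tabulate⁺ multiples-Unique) (AllPairs.tabulate⁺ multiples-disjoint)
    where
    0∉multiples : All (0 ≢_) (concat (tabulate multiples-below-Ajj))
    0∉multiples = All.concat⁺ (All.tabulate⁺ λ j → All.applyUpTo⁺₁ _ _ λ _ →
      <⇒≢ (≤-trans (positive (fsuc j)) (m≤m+n _ _)))

    multiples-Unique : ∀ j → Unique (multiples-below-Ajj j)
    multiples-Unique j = Unique.applyUpTo⁺₁ _ _ λ v<w _ →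
      <⇒≢ (*-monoˡ-< (d (fsuc j)) {{>-nonZero (positive (fsuc j))}} (s<s v<w))

    multiples-disjoint : ∀ {j k} → j ≢ k → Disjoint (multiples-below-Ajj j) (multiples-below-Ajj k)
    multiples-disjoint {j} {k} j≢k (x∈j , x∈k) =
      let v , 0<v , v<aⱼ , x≡vdⱼ = ∈-multiples-below-Ajj⁻ x∈j
          w , _   , _    , x≡wdₖ = ∈-multiples-below-Ajj⁻ x∈k
      in  ¬CombOthers-below-Ajj {d = d} (mg (fsuc j)) (isAjj j) 0<v v<aⱼ
            (subst (CombOthers d (fsuc j)) (trans (sym x≡wdₖ) x≡vdⱼ)
                   (*-CombOthers d (j≢k ∘ sym ∘ fsuc-injective) w))

  Σ[Ajj∸1]<d₀ : Σ[ (λ j → a j ∸ 1) ] < d zero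
  Σ[Ajj∸1]<d₀ = subst (_≤ d zero) length-aperyList
    (Apéry-length≤ (+-∈⟨⟩ {d = d} zero) aperyList-Apéry aperyList-Unique)

corollary7 : (n : ℕ) → 3 ≤ n → (d : Fin (suc n) → ℕ) →
    1 < d zero → StrictlyIncreasing d → gcdAll d ≡ 1 → MinimalGenerating d →
    (a : Fin n → ℕ) → (∀ j → IsAjj d (fsuc j) (a j)) →
    2 ^ n * Σ[ a ] ≤ 2 ^ n * d zero + 2 * n * (2 ^ n ∸ 1)
corollary7 zero ()
corollary7 (suc n) _ d _ _ _ mg a isAjj =
  m<n+o⇒p*m≤p*n+2*o*[p∸1] (*-monoʳ-≤ 2 (m^n>0 2 n)) (begin-strict
    Σ[ a ]                            ≤⟨ Σ[f]≤Σ[f∸1]+n a ⟩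
    Σ[ (λ j → a j ∸ 1) ] + suc n      <⟨ +-monoˡ-< (suc n) (Σ[Ajj∸1]<d₀ {d = d} mg isAjj) ⟩
    d zero + suc n                    ∎)
  where open ≤-Reasoning
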